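{- Let $d\ge2$ and let $O_{d+1}$ be the Odd graph, with eigenvalues $\theta_i=(-1)^i(d+1-i)$, $0\le i\le d$. Then \[ \min_{1\le r\le d}\left\{\frac{1-w_r(\theta_2)}{r^2}\right\}=\frac{1-w_d(\theta_2)}{d^2}. \]
   Context: The Odd graph $O_{d+1}$ has as vertices the $d$-subsets of $\{1,\dots,2d+1\}$, two being adjacent iff they are disjoint; it is distance-regular of diameter $d$ with distinct adjacency eigenvalues $\theta_i=(-1)^i(d+1-i)$, $0\le i\le d$ (so $\theta_2=d-1$ is the second largest). For a distance-regular graph with valency $k$ and intersection numbers $b_i,c_i$ (for $x,y$ at distance $i$, $c_i$ resp. $b_i$ neighbours of $y$ are at distance $i-1$ resp. $i+1$ from $x$), $a_i=k-b_i-c_i$, the cosine sequence of an eigenvalue $\theta$ is defined by $w_0(\theta)=1$, $w_1(\theta)=\theta/k$, $c_iw_{i-1}(\theta)+a_iw_i(\theta)+b_iw_{i+1}(\theta)=\theta w_i(\theta)$ ($1\le i\le d-1$). -}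

module Defs where

open import Data.Nat as ℕ using (ℕ; zero; suc; _<ᵇ_)
open import Data.Nat.DivMod using (_/_)
open import Data.Bool using (if_then_else_)
open import Data.Integer as ℤ using (ℤ; +_)
open import Data.Product using (_×_; _,_; proj₁)
open import Data.Rational as ℚ using (ℚ; 0ℚ; 1ℚ; _⊓_)

ℤ→ℚ : ℤ → ℚ
ℤ→ℚ z = z ℚ./ 1

ℕ→ℚ : ℕ → ℚ
ℕ→ℚ n = ℤ→ℚ (+ n)

-- Division of a rational by a natural number (division by 0 returns 0;
-- it is only ever applied to b_i with 0 ≤ i ≤ d-1, where b_i > 0).
divℕ : ℚ → ℕ → ℚ
divℕ q zero    = 0ℚ
divℕ q (suc n) = q ℚ.* ((+ 1) ℚ./ suc n)

-- The Odd graph O_{d+1}: valency k = d+1, diameter d, intersection array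
-- {d+1, d, d, d-1, d-1, ... ; 1, 1, 2, 2, ...}, i.e.
--   c_{2j-1} = c_{2j} = j,  b_{2j} = d+1-j,  b_{2j+1} = d-j  (0 ≤ i ≤ d-1),
--   b_d = 0,  a_i = k - b_i - c_i.

oddK : ℕ → ℕ
oddK d = suc d

oddC : ℕ → ℕ → ℕ
oddC d i = suc i / 2

oddB : ℕ → ℕ → ℕ
oddB d i = if i <ᵇ d then suc d ℕ.∸ (suc i / 2) else 0

oddA : ℕ → ℕ → ℤ
oddA d i = (+ oddK d) ℤ.- (+ oddB d i) ℤ.- (+ oddC d i)

signAlt : ℕ → ℤ → ℤ
signAlt zero          z = z
signAlt (suc zero)    z = ℤ.- z
signAlt (suc (suc i)) z = signAlt i z

oddθ : ℕ → ℕ → ℤ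
oddθ d i = signAlt i (+ (suc d ℕ.∸ i))

-- Cosine sequence of an eigenvalue θ for O_{d+1}:
--   w_0 = 1, w_1 = θ/k,
--   c_i w_{i-1} + a_i w_i + b_i w_{i+1} = θ w_i  (1 ≤ i ≤ d-1),
-- i.e. w_{i+1} = ((θ - a_i) w_i - c_i w_{i-1}) / b_i.
-- cosPair d θ n = (w_n , w_{n+1}).
cosPair : ℕ → ℤ → ℕ → ℚ × ℚ
cosPair d θ zero = 1ℚ , divℕ (ℤ→ℚ θ) (oddK d)
cosPair d θ (suc n) with cosPair d θ n
... | (p , q) = q , divℕ ((ℤ→ℚ (θ ℤ.- oddA d (suc n)) ℚ.* q)
                          ℚ.- (ℕ→ℚ (oddC d (suc n)) ℚ.* p))
                         (oddB d (suc n))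

cosine : ℕ → ℤ → ℕ → ℚ
cosine d θ i = proj₁ (cosPair d θ i)

-- min_{1 ≤ r ≤ n} f r   (for n ≥ 1; value for n = 0 is irrelevant)
min1to : ℕ → (ℕ → ℚ) → ℚ
min1to zero          f = f 1
min1to (suc zero)    f = f 1
min1to (suc (suc n)) f = min1to (suc n) f ⊓ f (suc (suc n))

ratio : ℕ → ℤ → ℕ → ℚ
ratio d θ r = divℕ (1ℚ ℚ.- cosine d θ r) (r ℕ.* r)

{-# OPTIONS --safe #-}
module Submission where

-- For θ₂ = d − 1 the cosine sequence is explicit: with S = (d − 1) d (d + 1),
--   S (1 − w_{2m})   = 2m (2d² − 1 − (2d − 1) m),
--   S (1 − w_{2m+1}) = 2 (d − m) ((2d − 1) m + d − 1),
-- which is checked against the three-term recurrence by polynomial identities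
-- (below the diameter a_i = 0 and b_i = k − c_i). Hence (1 − w_r)/r² is
-- non-increasing for 1 ≤ r ≤ d: after clearing denominators and writing
-- d = r + 1 + t, each step r ↦ r + 1 is a polynomial inequality whose two
-- sides differ by a polynomial in m and t with nonnegative coefficients.

open import Defs
open import Data.Nat using (ℕ; _≤_)
open import Relation.Binary.PropositionalEquality using (_≡_)

open import Algebra.Bundles.Raw using (RawRing)
open import Data.Bool using (true)
open import Data.Integer as ℤ using (ℤ; +_; +[1+_]; -[1+_]; 0ℤ; 1ℤ)
import Data.Integer.Properties as ℤP
import Data.Integer.Solver as ℤ-Solver
open import Data.Nat as ℕ using (zero; suc; _<_; z≤n; s≤s)
import Data.Nat.Coprimality as Coprimality
open import Data.Nat.Divisibility using (divides)
open import Data.Nat.DivMod using (_/_; m/n≤m; m/n≡1+[m∸n]/n; m*n/n≡m; +-distrib-/-∣ʳ)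
import Data.Nat.Properties as ℕP
open import Data.Product using (_,_)
open import Data.Rational as ℚ using (ℚ; mkℚ; 1ℚ)
import Data.Rational.Properties as ℚP
import Data.Rational.Solver as ℚ-Solver
open import Level using (0ℓ)
open import Relation.Binary.PropositionalEquality
  using (refl; sym; trans; cong; cong₂; subst; subst₂; module ≡-Reasoning)

ℤ→ℚ-mkℚ : ∀ i → ℤ→ℚ i ≡ mkℚ i 0 (Coprimality.sym (Coprimality.1-coprimeTo ℤ.∣ i ∣))
ℤ→ℚ-mkℚ i = ℚP.↥p/↧p≡p (mkℚ i 0 _)

ℤ→ℚ-homo-+ : ∀ i j → ℤ→ℚ (i ℤ.+ j) ≡ ℤ→ℚ i ℚ.+ ℤ→ℚ j
ℤ→ℚ-homo-+ i j rewrite ℤ→ℚ-mkℚ i | ℤ→ℚ-mkℚ j =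
  cong (ℚ._/ 1) (sym (cong₂ ℤ._+_ (ℤP.*-identityʳ i) (ℤP.*-identityʳ j)))

ℤ→ℚ-homo-* : ∀ i j → ℤ→ℚ (i ℤ.* j) ≡ ℤ→ℚ i ℚ.* ℤ→ℚ j
ℤ→ℚ-homo-* i j rewrite ℤ→ℚ-mkℚ i | ℤ→ℚ-mkℚ j = refl

ℤ→ℚ-homo‿- : ∀ i → ℤ→ℚ (ℤ.- i) ≡ ℚ.- ℤ→ℚ i
ℤ→ℚ-homo‿- i rewrite ℤ→ℚ-mkℚ i | ℤ→ℚ-mkℚ (ℤ.- i) with i
... | + zero   = refl
... | + suc _  = refl
... | -[1+ _ ] = refl

ℤ→ℚ-homo-sub : ∀ i j → ℤ→ℚ (i ℤ.- j) ≡ ℤ→ℚ i ℚ.- ℤ→ℚ j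
ℤ→ℚ-homo-sub i j = trans (ℤ→ℚ-homo-+ i (ℤ.- j)) (cong (ℤ→ℚ i ℚ.+_) (ℤ→ℚ-homo‿- j))

ℤ→ℚ-mono-≤ : ∀ {i j} → i ℤ.≤ j → ℤ→ℚ i ℚ.≤ ℤ→ℚ j
ℤ→ℚ-mono-≤ {i} {j} i≤j rewrite ℤ→ℚ-mkℚ i | ℤ→ℚ-mkℚ j =
  ℚ.*≤* (subst₂ ℤ._≤_ (sym (ℤP.*-identityʳ i)) (sym (ℤP.*-identityʳ j)) i≤j)

ℤ→ℚ-pos : ∀ i → .{{ℤ.Positive i}} → ℚ.Positive (ℤ→ℚ i)
ℤ→ℚ-pos +[1+ n ] = ℚP.normalize-pos (suc n) 1

i-[i-j]≡j : ∀ i j → i ℤ.- (i ℤ.- j) ≡ j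
i-[i-j]≡j = solve 2 (λ i j → i :- (i :- j) := j) refl
  where open ℤ-Solver.+-*-Solver

*-one-minus : ∀ s x g → ℤ→ℚ s ℚ.* x ≡ ℤ→ℚ (s ℤ.- g) → ℤ→ℚ s ℚ.* (1ℚ ℚ.- x) ≡ ℤ→ℚ g
*-one-minus s x g sx≡s-g = begin
  ℤ→ℚ s ℚ.* (1ℚ ℚ.- x)      ≡⟨ solve 2 (λ s x → s :* (con 1ℚ :- x) := s :- s :* x) refl (ℤ→ℚ s) x ⟩
  ℤ→ℚ s ℚ.- ℤ→ℚ s ℚ.* x     ≡⟨ cong (λ y → ℤ→ℚ s ℚ.- y) sx≡s-g ⟩
  ℤ→ℚ s ℚ.- ℤ→ℚ (s ℤ.- g)   ≡⟨ ℤ→ℚ-homo-sub s (s ℤ.- g) ⟨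
  ℤ→ℚ (s ℤ.- (s ℤ.- g))     ≡⟨ cong ℤ→ℚ (i-[i-j]≡j s g) ⟩
  ℤ→ℚ g                     ∎
  where
  open ≡-Reasoning
  open ℚ-Solver.+-*-Solver

*-linear-combination : ∀ s p q t c X Y → s ℚ.* p ≡ ℤ→ℚ X → s ℚ.* q ≡ ℤ→ℚ Y →
  s ℚ.* (ℤ→ℚ t ℚ.* q ℚ.- ℕ→ℚ c ℚ.* p) ≡ ℤ→ℚ (t ℤ.* Y ℤ.- + c ℤ.* X)
*-linear-combination s p q t c X Y sp≡X sq≡Y = begin
  s ℚ.* (T ℚ.* q ℚ.- C ℚ.* p)          ≡⟨ regroup ⟩
  T ℚ.* (s ℚ.* q) ℚ.- C ℚ.* (s ℚ.* p)  ≡⟨ cong₂ (λ u v → T ℚ.* u ℚ.- C ℚ.* v) sq≡Y sp≡X ⟩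
  T ℚ.* ℤ→ℚ Y ℚ.- C ℚ.* ℤ→ℚ X          ≡⟨ cong₂ ℚ._-_ (ℤ→ℚ-homo-* t Y) (ℤ→ℚ-homo-* (+ c) X) ⟨
  ℤ→ℚ (t ℤ.* Y) ℚ.- ℤ→ℚ (+ c ℤ.* X)    ≡⟨ ℤ→ℚ-homo-sub (t ℤ.* Y) (+ c ℤ.* X) ⟨
  ℤ→ℚ (t ℤ.* Y ℤ.- + c ℤ.* X)          ∎
  where
  open ≡-Reasoning
  T = ℤ→ℚ t
  C = ℕ→ℚ c
  regroup : s ℚ.* (T ℚ.* q ℚ.- C ℚ.* p) ≡ T ℚ.* (s ℚ.* q) ℚ.- C ℚ.* (s ℚ.* p)
  regroup = solve 5 (λ s p q T C → s :* (T :* q :- C :* p) := T :* (s :* q) :- C :* (s :* p)) refl s p q T C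
    where open ℚ-Solver.+-*-Solver

*-divℕ : ∀ x y n → x ℚ.* divℕ y n ≡ divℕ (x ℚ.* y) n
*-divℕ x y zero    = ℚP.*-zeroʳ x
*-divℕ x y (suc n) = sym (ℚP.*-assoc x y _)

divℕ-cancelˡ : ∀ b x → divℕ (ℕ→ℚ (suc b) ℚ.* x) (suc b) ≡ x
divℕ-cancelˡ b x = begin
  B ℚ.* x ℚ.* (+ 1 ℚ./ suc b)    ≡⟨ solve 3 (λ B x i → B :* x :* i := x :* (B :* i)) refl B x (+ 1 ℚ./ suc b) ⟩
  x ℚ.* (B ℚ.* (+ 1 ℚ./ suc b))  ≡⟨ cong (x ℚ.*_) B*1/B≡1 ⟩
  x ℚ.* 1ℚ                       ≡⟨ ℚP.*-identityʳ x ⟩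
  x                              ∎
  where
  open ≡-Reasoning
  open ℚ-Solver.+-*-Solver
  B = ℕ→ℚ (suc b)
  B*1/B≡1 : B ℚ.* (+ 1 ℚ./ suc b) ≡ 1ℚ
  B*1/B≡1 = trans
    (cong₂ ℚ._*_ (ℤ→ℚ-mkℚ (+ suc b)) (ℚP.normalize-coprime (Coprimality.1-coprimeTo (suc b))))
    (ℚP.*-inverseʳ (mkℚ (+ suc b) 0 (Coprimality.sym (Coprimality.1-coprimeTo (suc b)))))

*-divℕ-exact : ∀ s x b z → s ℚ.* x ≡ ℤ→ℚ (+ suc b ℤ.* z) → s ℚ.* divℕ x (suc b) ≡ ℤ→ℚ z
*-divℕ-exact s x b z sx≡bz = begin
  s ℚ.* divℕ x (suc b)                  ≡⟨ *-divℕ s x (suc b) ⟩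
  divℕ (s ℚ.* x) (suc b)                ≡⟨ cong (λ y → divℕ y (suc b)) sx≡bz ⟩
  divℕ (ℤ→ℚ (+ suc b ℤ.* z)) (suc b)    ≡⟨ cong (λ y → divℕ y (suc b)) (ℤ→ℚ-homo-* (+ suc b) z) ⟩
  divℕ (ℕ→ℚ (suc b) ℚ.* ℤ→ℚ z) (suc b)  ≡⟨ divℕ-cancelˡ b (ℤ→ℚ z) ⟩
  ℤ→ℚ z                                 ∎
  where open ≡-Reasoning

*-divℕ-rescale : ∀ s a b z k → s ℚ.* z ≡ ℤ→ℚ k →
  s ℚ.* (ℕ→ℚ (suc a) ℚ.* ℕ→ℚ (suc b)) ℚ.* divℕ z (suc b) ≡ ℤ→ℚ (+ suc a ℤ.* k)
*-divℕ-rescale s a b z k sz≡k = begin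
  s ℚ.* (A ℚ.* B) ℚ.* divℕ z (suc b)        ≡⟨ *-divℕ (s ℚ.* (A ℚ.* B)) z (suc b) ⟩
  divℕ (s ℚ.* (A ℚ.* B) ℚ.* z) (suc b)      ≡⟨ cong (λ q → divℕ q (suc b)) (begin
    s ℚ.* (A ℚ.* B) ℚ.* z                     ≡⟨ regroup ⟩
    B ℚ.* (A ℚ.* (s ℚ.* z))                   ≡⟨ cong (λ q → B ℚ.* (A ℚ.* q)) sz≡k ⟩
    B ℚ.* (A ℚ.* ℤ→ℚ k)                       ≡⟨ cong (B ℚ.*_) (ℤ→ℚ-homo-* (+ suc a) k) ⟨
    B ℚ.* ℤ→ℚ (+ suc a ℤ.* k)                 ∎) ⟩
  divℕ (B ℚ.* ℤ→ℚ (+ suc a ℤ.* k)) (suc b)  ≡⟨ divℕ-cancelˡ b (ℤ→ℚ (+ suc a ℤ.* k)) ⟩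
  ℤ→ℚ (+ suc a ℤ.* k)                       ∎
  where
  open ≡-Reasoning
  A = ℕ→ℚ (suc a)
  B = ℕ→ℚ (suc b)
  regroup : s ℚ.* (A ℚ.* B) ℚ.* z ≡ B ℚ.* (A ℚ.* (s ℚ.* z))
  regroup = solve 4 (λ s A B z → s :* (A :* B) :* z := B :* (A :* (s :* z))) refl s A B z
    where open ℚ-Solver.+-*-Solver

divℕ-≤-divℕ : ∀ s .{{_ : ℤ.Positive s}} a b x y g h →
  ℤ→ℚ s ℚ.* x ≡ ℤ→ℚ g → ℤ→ℚ s ℚ.* y ≡ ℤ→ℚ h →
  + suc a ℤ.* h ℤ.≤ + suc b ℤ.* g → divℕ y (suc b) ℚ.≤ divℕ x (suc a)
divℕ-≤-divℕ s a b x y g h sx≡g sy≡h ah≤bg =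
  ℚP.*-cancelˡ-≤-pos (S ℚ.* (A ℚ.* B)) {{S*[A*B]-pos}}
    (subst₂ ℚ._≤_ (sym (*-divℕ-rescale S a b y h sy≡h))
      (sym (trans (cong (λ k → S ℚ.* k ℚ.* divℕ x (suc a)) (ℚP.*-comm A B)) (*-divℕ-rescale S b a x g sx≡g)))
      (ℤ→ℚ-mono-≤ ah≤bg))
  where
  S = ℤ→ℚ s
  A = ℕ→ℚ (suc a)
  B = ℕ→ℚ (suc b)
  S*[A*B]-pos : ℚ.Positive (S ℚ.* (A ℚ.* B))
  S*[A*B]-pos = ℚP.pos*pos⇒pos S {{ℤ→ℚ-pos s}} (A ℚ.* B)
    {{ℚP.pos*pos⇒pos A {{ℤ→ℚ-pos (+ suc a)}} B {{ℤ→ℚ-pos (+ suc b)}}}}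

-- scale d = S and, for θ₂, evenGap d m = S (1 − w_{2m}), oddGap d m = S (1 − w_{2m+1}).
-- They are defined over an arbitrary raw ring so that the same definitions can be
-- handed to the ring solver as polynomial syntax.
module Gaps {c ℓ} (R : RawRing c ℓ) where
  open RawRing R

  private
    infixl 6 _-_
    _-_ : Carrier → Carrier → Carrier
    x - y = x + - y

    2# : Carrier
    2# = 1# + 1#

  scale : Carrier → Carrier
  scale d = d * (d - 1#) * (1# + d)

  evenGap oddGap : Carrier → Carrier → Carrier
  evenGap d m = 2# * m * (2# * d * d - 1# - (2# * d - 1#) * m)
  oddGap  d m = 2# * (d - m) * ((2# * d - 1#) * m + d - 1#)

open Gaps ℤ.+-*-rawRing

polynomialRawRing : ℕ → RawRing 0ℓ 0ℓ
polynomialRawRing n = record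
  { Carrier = Polynomial n
  ; _≈_     = _≡_
  ; _+_     = _:+_
  ; _*_     = _:*_
  ; -_      = :-_
  ; 0#      = con 0ℤ
  ; 1#      = con 1ℤ
  }
  where open ℤ-Solver.+-*-Solver using (Polynomial; _:+_; _:*_; :-_; con)

module GapPolynomials {n : ℕ} = Gaps (polynomialRawRing n)

module _ where
  open ℤ-Solver.+-*-Solver
  private module P = GapPolynomials

  evenGap-zero : ∀ d → evenGap d 0ℤ ≡ 0ℤ
  evenGap-zero = solve 1 (λ d → P.evenGap d (con 0ℤ) := con 0ℤ) refl

  first-cosine-identity : ∀ d → scale d ℤ.* (d ℤ.- 1ℤ) ≡ (1ℤ ℤ.+ d) ℤ.* (scale d ℤ.- oddGap d 0ℤ)
  first-cosine-identity = solve 1 (λ d →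
    P.scale d :* (d :- con 1ℤ) := (con 1ℤ :+ d) :* (P.scale d :- P.oddGap d (con 0ℤ))) refl

  even-recurrence : ∀ d m →
    (d ℤ.- 1ℤ) ℤ.* (scale d ℤ.- oddGap d m) ℤ.- (1ℤ ℤ.+ m) ℤ.* (scale d ℤ.- evenGap d m)
      ≡ (1ℤ ℤ.+ d ℤ.- (1ℤ ℤ.+ m)) ℤ.* (scale d ℤ.- evenGap d (1ℤ ℤ.+ m))
  even-recurrence = solve 2 (λ d m →
    (d :- con 1ℤ) :* (P.scale d :- P.oddGap d m) :- (con 1ℤ :+ m) :* (P.scale d :- P.evenGap d m)
      := (con 1ℤ :+ d :- (con 1ℤ :+ m)) :* (P.scale d :- P.evenGap d (con 1ℤ :+ m))) refl

  odd-recurrence : ∀ d m →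
    (d ℤ.- 1ℤ) ℤ.* (scale d ℤ.- evenGap d (1ℤ ℤ.+ m)) ℤ.- (1ℤ ℤ.+ m) ℤ.* (scale d ℤ.- oddGap d m)
      ≡ (1ℤ ℤ.+ d ℤ.- (1ℤ ℤ.+ m)) ℤ.* (scale d ℤ.- oddGap d (1ℤ ℤ.+ m))
  odd-recurrence = solve 2 (λ d m →
    (d :- con 1ℤ) :* (P.scale d :- P.evenGap d (con 1ℤ :+ m)) :- (con 1ℤ :+ m) :* (P.scale d :- P.oddGap d m)
      := (con 1ℤ :+ d :- (con 1ℤ :+ m)) :* (P.scale d :- P.oddGap d (con 1ℤ :+ m))) refl

-- Opened only now because inside Gaps the name _+_ is the ring addition.
open Data.Nat using (_+_)

pos-∸ : ∀ {m n} → n ≤ m → + (m ℕ.∸ n) ≡ + m ℤ.- + n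
pos-∸ {m} {n} n≤m = sym (trans (ℤP.m-n≡m⊖n m n) (ℤP.⊖-≥ n≤m))

oddC-below : ∀ {d i} → i < d → oddC d i ≤ d
oddC-below {d} {i} i<d = ℕP.≤-trans (m/n≤m (suc i) 2) i<d

oddB-below : ∀ {d i} → i < d → oddB d i ≡ suc (d ℕ.∸ oddC d i)
oddB-below {d} {i} i<d with i ℕ.<ᵇ d | ℕP.<⇒<ᵇ i<d
... | true | _ = ℕP.+-∸-assoc 1 {d} {oddC d i} (oddC-below i<d)

oddA-below : ∀ {d i} → i < d → oddA d i ≡ 0ℤ
oddA-below {d} {i} i<d = begin
  + suc d ℤ.- + b ℤ.- + c      ≡⟨ cong (λ k → + k ℤ.- + b ℤ.- + c) k≡b+c ⟩
  + b ℤ.+ + c ℤ.- + b ℤ.- + c  ≡⟨ solve 2 (λ b c → b :+ c :- b :- c := con 0ℤ) refl (+ b) (+ c) ⟩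
  0ℤ                           ∎
  where
  open ≡-Reasoning
  open ℤ-Solver.+-*-Solver
  b = oddB d i
  c = oddC d i
  k≡b+c : suc d ≡ b + c
  k≡b+c = begin
    suc d              ≡⟨ ℕP.m∸n+n≡m (ℕP.m≤n⇒m≤1+n (oddC-below i<d)) ⟨
    suc d ℕ.∸ c + c    ≡⟨ cong (_+ c) (ℕP.+-∸-assoc 1 (oddC-below i<d)) ⟩
    suc (d ℕ.∸ c) + c  ≡⟨ cong (_+ c) (oddB-below i<d) ⟨
    b + c              ∎

cosine-below : ∀ {d θ n} → suc n < d →
  cosine d θ (suc (suc n)) ≡
    divℕ (ℤ→ℚ θ ℚ.* cosine d θ (suc n) ℚ.- ℕ→ℚ (oddC d (suc n)) ℚ.* cosine d θ n)
         (suc (d ℕ.∸ oddC d (suc n)))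
cosine-below {d} {θ} {n} n+1<d =
  cong₂ (λ θ-a b → divℕ (ℤ→ℚ θ-a ℚ.* cosine d θ (suc n) ℚ.- ℕ→ℚ c ℚ.* cosine d θ n) b)
        (trans (cong (λ a → θ ℤ.- a) (oddA-below n+1<d)) (ℤP.+-identityʳ θ))
        (oddB-below n+1<d)
  where c = oddC d (suc n)

cosine-scaled-step : ∀ {d n} θ s X Y Z → suc n < d →
  s ℚ.* cosine d θ n ≡ ℤ→ℚ X → s ℚ.* cosine d θ (suc n) ≡ ℤ→ℚ Y →
  θ ℤ.* Y ℤ.- + oddC d (suc n) ℤ.* X ≡ (+ suc d ℤ.- + oddC d (suc n)) ℤ.* Z →
  s ℚ.* cosine d θ (suc (suc n)) ≡ ℤ→ℚ Z
cosine-scaled-step {d} {n} θ s X Y Z n+1<d sw₀≡X sw₁≡Y recurrence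
  rewrite cosine-below {θ = θ} n+1<d =
  *-divℕ-exact s (ℤ→ℚ θ ℚ.* w₁ ℚ.- ℕ→ℚ c ℚ.* w₀) (d ℕ.∸ c) Z
    (trans (*-linear-combination s w₀ w₁ θ c X Y sw₀≡X sw₁≡Y) (cong ℤ→ℚ (begin
      θ ℤ.* Y ℤ.- + c ℤ.* X    ≡⟨ recurrence ⟩
      (+ suc d ℤ.- + c) ℤ.* Z  ≡⟨ cong (ℤ._* Z) (pos-∸ (ℕP.m≤n⇒m≤1+n (oddC-below n+1<d))) ⟨
      + (suc d ℕ.∸ c) ℤ.* Z    ≡⟨ cong (λ b → + b ℤ.* Z) (ℕP.+-∸-assoc 1 (oddC-below n+1<d)) ⟩
      + suc (d ℕ.∸ c) ℤ.* Z    ∎)))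
  where
  open ≡-Reasoning
  c = oddC d (suc n)
  w₀ = cosine d θ n
  w₁ = cosine d θ (suc n)

m+m≡m*2 : ∀ m → m + m ≡ m ℕ.* 2
m+m≡m*2 m = trans (cong (λ k → m + k) (sym (ℕP.+-identityʳ m))) (ℕP.*-comm 2 m)

[m+m]/2≡m : ∀ m → (m + m) / 2 ≡ m
[m+m]/2≡m m = trans (cong (_/ 2) (m+m≡m*2 m)) (m*n/n≡m m 2)

[1+m+m]/2≡m : ∀ m → suc (m + m) / 2 ≡ m
[1+m+m]/2≡m m = trans (+-distrib-/-∣ʳ 1 (divides m (m+m≡m*2 m))) ([m+m]/2≡m m)

[1+m]+[1+m]≡2+m+m : ∀ m → suc m + suc m ≡ suc (suc (m + m))
[1+m]+[1+m]≡2+m+m m = cong suc (ℕP.+-suc m m)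

oddC-odd : ∀ d m → oddC d (suc (m + m)) ≡ suc m
oddC-odd d m = trans (m/n≡1+[m∸n]/n {suc (suc (m + m))} {2} (s≤s (s≤s z≤n))) (cong suc ([m+m]/2≡m m))

oddC-even : ∀ d m → oddC d (suc (suc (m + m))) ≡ suc m
oddC-even d m = trans (m/n≡1+[m∸n]/n {suc (suc (suc (m + m)))} {2} (s≤s (s≤s z≤n))) (cong suc ([1+m+m]/2≡m m))

oddθ₂≡d-1 : ∀ {d} → 1 ≤ d → oddθ d 2 ≡ + d ℤ.- 1ℤ
oddθ₂≡d-1 (s≤s z≤n) = refl

-- Indices 2m and 2m + 1 are written m + m and suc (m + m): then + (m + m) is
-- definitionally + m ℤ.+ + m, which is what the ring identities are stated in.
module CosineOfθ₂ (d : ℕ) where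
  private
    θ : ℤ
    θ = oddθ d 2
    D : ℤ
    D = + d
    S : ℚ
    S = ℤ→ℚ (scale D)
    w : ℕ → ℚ
    w = cosine d θ
    even-numerator odd-numerator : ℕ → ℤ
    even-numerator m = scale D ℤ.- evenGap D (+ m)
    odd-numerator  m = scale D ℤ.- oddGap D (+ m)

    θ₂-step : ∀ {n m} X Y Z → suc n < d → oddC d (suc n) ≡ suc m →
      S ℚ.* w n ≡ ℤ→ℚ X → S ℚ.* w (suc n) ≡ ℤ→ℚ Y →
      (D ℤ.- 1ℤ) ℤ.* Y ℤ.- (1ℤ ℤ.+ + m) ℤ.* X ≡ (1ℤ ℤ.+ D ℤ.- (1ℤ ℤ.+ + m)) ℤ.* Z →
      S ℚ.* w (suc (suc n)) ≡ ℤ→ℚ Z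
    θ₂-step {n} {m} X Y Z n+1<d c≡1+m sw₀≡X sw₁≡Y recurrence =
      cosine-scaled-step θ S X Y Z n+1<d sw₀≡X sw₁≡Y (begin
        θ ℤ.* Y ℤ.- + c ℤ.* X               ≡⟨ cong₂ (λ t c → t ℤ.* Y ℤ.- + c ℤ.* X) (oddθ₂≡d-1 1≤d) c≡1+m ⟩
        (D ℤ.- 1ℤ) ℤ.* Y ℤ.- + suc m ℤ.* X  ≡⟨ recurrence ⟩
        (+ suc d ℤ.- + suc m) ℤ.* Z         ≡⟨ cong (λ c → (+ suc d ℤ.- + c) ℤ.* Z) c≡1+m ⟨
        (+ suc d ℤ.- + c) ℤ.* Z             ∎)
      where
      open ≡-Reasoning
      c = oddC d (suc n)
      1≤d = ℕP.≤-trans (s≤s z≤n) n+1<d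

  cosine-even : ∀ m → m + m ≤ d → S ℚ.* w (m + m) ≡ ℤ→ℚ (even-numerator m)
  cosine-odd  : ∀ m → suc (m + m) ≤ d → S ℚ.* w (suc (m + m)) ≡ ℤ→ℚ (odd-numerator m)

  cosine-even zero _ = trans (ℚP.*-identityʳ S) (cong ℤ→ℚ (sym (begin
    scale D ℤ.- evenGap D 0ℤ  ≡⟨ cong (λ g → scale D ℤ.- g) (evenGap-zero D) ⟩
    scale D ℤ.- 0ℤ            ≡⟨ ℤP.+-identityʳ (scale D) ⟩
    scale D                   ∎)))
    where open ≡-Reasoning
  cosine-even (suc m) 2m+2≤d =
    subst (λ i → S ℚ.* w i ≡ ℤ→ℚ (even-numerator (suc m))) (sym ([1+m]+[1+m]≡2+m+m m))
      (θ₂-step {n = m + m} (even-numerator m) (odd-numerator m) (even-numerator (suc m))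
        2m+2≤d′ (oddC-odd d m)
        (cosine-even m (ℕP.≤-trans (ℕP.n≤1+n _) (ℕP.<⇒≤ 2m+2≤d′)))
        (cosine-odd m (ℕP.<⇒≤ 2m+2≤d′))
        (even-recurrence D (+ m)))
    where 2m+2≤d′ = subst (_≤ d) ([1+m]+[1+m]≡2+m+m m) 2m+2≤d

  cosine-odd zero 1≤d = *-divℕ-exact S (ℤ→ℚ θ) d (odd-numerator 0) (begin
    S ℚ.* ℤ→ℚ θ                            ≡⟨ ℤ→ℚ-homo-* (scale D) θ ⟨
    ℤ→ℚ (scale D ℤ.* θ)                    ≡⟨ cong (λ t → ℤ→ℚ (scale D ℤ.* t)) (oddθ₂≡d-1 1≤d) ⟩
    ℤ→ℚ (scale D ℤ.* (D ℤ.- 1ℤ))           ≡⟨ cong ℤ→ℚ (first-cosine-identity D) ⟩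
    ℤ→ℚ (+ suc d ℤ.* odd-numerator 0)      ∎)
    where open ≡-Reasoning
  cosine-odd (suc m) 2m+3≤d =
    subst (λ i → S ℚ.* w (suc i) ≡ ℤ→ℚ (odd-numerator (suc m))) (sym ([1+m]+[1+m]≡2+m+m m))
      (θ₂-step {n = suc (m + m)} (odd-numerator m) (even-numerator (suc m)) (odd-numerator (suc m))
        2m+3≤d′ (oddC-even d m)
        (cosine-odd m (ℕP.≤-trans (ℕP.n≤1+n _) (ℕP.<⇒≤ 2m+3≤d′)))
        (subst (λ i → S ℚ.* w i ≡ ℤ→ℚ (even-numerator (suc m))) ([1+m]+[1+m]≡2+m+m m)
          (cosine-even (suc m) (ℕP.<⇒≤ 2m+3≤d)))
        (odd-recurrence D (+ m)))
    where 2m+3≤d′ = subst (λ i → suc i ≤ d) ([1+m]+[1+m]≡2+m+m m) 2m+3≤d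

  gap-even : ∀ m → m + m ≤ d → S ℚ.* (1ℚ ℚ.- w (m + m)) ≡ ℤ→ℚ (evenGap D (+ m))
  gap-even m 2m≤d = *-one-minus (scale D) (w (m + m)) (evenGap D (+ m)) (cosine-even m 2m≤d)

  gap-odd : ∀ m → suc (m + m) ≤ d → S ℚ.* (1ℚ ℚ.- w (suc (m + m))) ≡ ℤ→ℚ (oddGap D (+ m))
  gap-odd m 2m+1≤d = *-one-minus (scale D) (w (suc (m + m))) (oddGap D (+ m)) (cosine-odd m 2m+1≤d)

open CosineOfθ₂ using (gap-even; gap-odd)

0≤i*j : ∀ i j → 0ℤ ℤ.≤ i → 0ℤ ℤ.≤ j → 0ℤ ℤ.≤ i ℤ.* j
0≤i*j (+ a) (+ b) _ _ = subst (0ℤ ℤ.≤_) (ℤP.pos-* a b) (ℤ.+≤+ z≤n)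

≤-by-certificate : ∀ {i j} c → 0ℤ ℤ.≤ c → j ≡ i ℤ.+ c → i ℤ.≤ j
≤-by-certificate {i} c 0≤c refl =
  ℤP.≤-trans (ℤP.≤-reflexive (sym (ℤP.+-identityʳ i))) (ℤP.+-monoʳ-≤ i 0≤c)

-- The step from r to r + 1, cross-multiplied, for d = r + 1 + t. The certificates are
-- the differences of the two sides, written so that they are visibly nonnegative.
module _ (m t : ℕ) where
  open ℤ-Solver.+-*-Solver
  private
    module P = GapPolynomials
    0≤n : ∀ {n} → 0ℤ ℤ.≤ + n
    0≤n = ℤ.+≤+ z≤n

  even-gap-inequality :
    let r = m + m ; d = + (suc r + t) in
    + r ℤ.* + r ℤ.* oddGap d (+ m) ℤ.≤ + suc r ℤ.* + suc r ℤ.* evenGap d (+ m)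
  even-gap-inequality = ≤-by-certificate certificate 0≤certificate
    (solve 2 (λ m t →
       let R = m :+ m
           D = con 1ℤ :+ R :+ t
           Y = D :* (D :+ R :+ t) :+ t
           X = (con 1ℤ :+ R) :* Y :+ (con 1ℤ :+ D :+ D) :* m
       in (con 1ℤ :+ R) :* (con 1ℤ :+ R) :* P.evenGap D m := R :* R :* P.oddGap D m :+ R :* X)
      refl (+ m) (+ t))
    where
    R D Y X certificate : ℤ
    R = + m ℤ.+ + m
    D = 1ℤ ℤ.+ R ℤ.+ + t
    Y = D ℤ.* (D ℤ.+ R ℤ.+ + t) ℤ.+ + t
    X = (1ℤ ℤ.+ R) ℤ.* Y ℤ.+ (1ℤ ℤ.+ D ℤ.+ D) ℤ.* + m
    certificate = R ℤ.* X
    0≤certificate : 0ℤ ℤ.≤ certificate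
    0≤certificate = 0≤i*j R X 0≤n (ℤP.+-mono-≤
      (0≤i*j (1ℤ ℤ.+ R) Y 0≤n (ℤP.+-mono-≤ (0≤i*j D (D ℤ.+ R ℤ.+ + t) 0≤n 0≤n) 0≤n))
      (0≤i*j (1ℤ ℤ.+ D ℤ.+ D) (+ m) 0≤n 0≤n))

  odd-gap-inequality :
    let r = suc (m + m) ; r′ = suc m + suc m ; d = + (r′ + t) in
    + r ℤ.* + r ℤ.* evenGap d (+ suc m) ℤ.≤ + r′ ℤ.* + r′ ℤ.* oddGap d (+ m)
  odd-gap-inequality = ≤-by-certificate certificate 0≤certificate
    (solve 2 (λ m t →
       let R  = con 1ℤ :+ (m :+ m)
           R′ = (con 1ℤ :+ m) :+ (con 1ℤ :+ m)
           S  = con 1ℤ :+ (m :+ m) :+ t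
           Q  = con 1ℤ :+ S :+ S
           Z  = (m :+ m) :* (Q :* Q :+ (S :+ S)) :+ ((con 1ℤ :+ S) :+ (con 1ℤ :+ S)) :* (S :+ S)
                :+ (m :+ m :+ m :+ m) :* ((con 1ℤ :+ m) :+ (con 1ℤ :+ m))
       in R′ :* R′ :* P.oddGap (R′ :+ t) m := R :* R :* P.evenGap (R′ :+ t) (con 1ℤ :+ m) :+ (con 1ℤ :+ m) :* Z)
      refl (+ m) (+ t))
    where
    S Q Z certificate : ℤ
    S = 1ℤ ℤ.+ (+ m ℤ.+ + m) ℤ.+ + t
    Q = 1ℤ ℤ.+ S ℤ.+ S
    Z = (+ m ℤ.+ + m) ℤ.* (Q ℤ.* Q ℤ.+ (S ℤ.+ S)) ℤ.+ ((1ℤ ℤ.+ S) ℤ.+ (1ℤ ℤ.+ S)) ℤ.* (S ℤ.+ S)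
        ℤ.+ (+ m ℤ.+ + m ℤ.+ + m ℤ.+ + m) ℤ.* ((1ℤ ℤ.+ + m) ℤ.+ (1ℤ ℤ.+ + m))
    certificate = (1ℤ ℤ.+ + m) ℤ.* Z
    0≤certificate : 0ℤ ℤ.≤ certificate
    0≤certificate = 0≤i*j (1ℤ ℤ.+ + m) Z 0≤n (ℤP.+-mono-≤ (ℤP.+-mono-≤
      (0≤i*j (+ m ℤ.+ + m) (Q ℤ.* Q ℤ.+ (S ℤ.+ S)) 0≤n (ℤP.+-mono-≤ (0≤i*j Q Q 0≤n 0≤n) 0≤n))
      (0≤i*j ((1ℤ ℤ.+ S) ℤ.+ (1ℤ ℤ.+ S)) (S ℤ.+ S) 0≤n 0≤n))
      (0≤i*j (+ m ℤ.+ + m ℤ.+ + m ℤ.+ + m) ((1ℤ ℤ.+ + m) ℤ.+ (1ℤ ℤ.+ + m)) 0≤n 0≤n))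

scale-positive : ∀ {d} → 2 ≤ d → ℤ.Positive (scale (+ d))
scale-positive (s≤s (s≤s z≤n)) = _

ratio-antitone-even : ∀ {d} m → suc (suc m + suc m) ≤ d →
  ratio d (oddθ d 2) (suc (suc m + suc m)) ℚ.≤ ratio d (oddθ d 2) (suc m + suc m)
ratio-antitone-even {d} m r<d with ℕP.m≤n⇒∃[o]m+o≡n r<d
... | t , refl =
  divℕ-≤-divℕ (scale (+ d)) {{scale-positive (ℕP.≤-trans (ℕP.m≤m+n 2 _) r<d)}}
    (ℕ.pred (r ℕ.* r)) (ℕ.pred (suc r ℕ.* suc r)) (1ℚ ℚ.- cosine d θ r) (1ℚ ℚ.- cosine d θ (suc r))
    (evenGap (+ d) (+ suc m)) (oddGap (+ d) (+ suc m))
    (gap-even d (suc m) (ℕP.<⇒≤ r<d)) (gap-odd d (suc m) r<d) (even-gap-inequality (suc m) t)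
  where
  r = suc m + suc m
  θ = oddθ d 2

ratio-antitone-odd : ∀ {d} m → suc m + suc m ≤ d →
  ratio d (oddθ d 2) (suc m + suc m) ℚ.≤ ratio d (oddθ d 2) (suc (m + m))
ratio-antitone-odd {d} m r<d with ℕP.m≤n⇒∃[o]m+o≡n r<d
... | t , refl =
  divℕ-≤-divℕ (scale (+ d)) {{scale-positive (ℕP.≤-trans 2≤r′ r<d)}}
    (ℕ.pred (r ℕ.* r)) (ℕ.pred (r′ ℕ.* r′)) (1ℚ ℚ.- cosine d θ r) (1ℚ ℚ.- cosine d θ r′)
    (oddGap (+ d) (+ m)) (evenGap (+ d) (+ suc m))
    (gap-odd d m (ℕP.<⇒≤ (subst (_≤ d) ([1+m]+[1+m]≡2+m+m m) r<d))) (gap-even d (suc m) r<d)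
    (odd-gap-inequality m t)
  where
  r = suc (m + m)
  r′ = suc m + suc m
  θ = oddθ d 2
  2≤r′ : 2 ≤ r′
  2≤r′ = ℕP.+-mono-≤ (s≤s z≤n) (s≤s z≤n)

data EvenOrOdd : ℕ → Set where
  even : ∀ m → EvenOrOdd (m + m)
  odd  : ∀ m → EvenOrOdd (suc (m + m))

evenOrOdd : ∀ n → EvenOrOdd n
evenOrOdd zero = even 0
evenOrOdd (suc n) with evenOrOdd n
... | even m = odd m
... | odd m  = subst EvenOrOdd ([1+m]+[1+m]≡2+m+m m) (even (suc m))

ratio-antitone : ∀ {d} r → 1 ≤ r → suc r ≤ d → ratio d (oddθ d 2) (suc r) ℚ.≤ ratio d (oddθ d 2) r
ratio-antitone {d} r 1≤r r<d with evenOrOdd r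
... | even (suc m) = ratio-antitone-even m r<d
... | odd m        =
  subst (λ i → ratio d (oddθ d 2) i ℚ.≤ ratio d (oddθ d 2) (suc (m + m))) ([1+m]+[1+m]≡2+m+m m)
    (ratio-antitone-odd m (subst (_≤ d) (sym ([1+m]+[1+m]≡2+m+m m)) r<d))

min1to-antitone : ∀ n (f : ℕ → ℚ) → (∀ r → 1 ≤ r → r ≤ n → f (suc r) ℚ.≤ f r) →
  min1to (suc n) f ≡ f (suc n)
min1to-antitone zero    f _        = refl
min1to-antitone (suc n) f antitone = begin
  min1to (suc n) f ℚ.⊓ f (suc (suc n))  ≡⟨ cong (ℚ._⊓ f (suc (suc n))) (min1to-antitone n f antitone′) ⟩
  f (suc n) ℚ.⊓ f (suc (suc n))         ≡⟨ ℚP.p≥q⇒p⊓q≡q (antitone (suc n) (s≤s z≤n) ℕP.≤-refl) ⟩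
  f (suc (suc n))                       ∎
  where
  open ≡-Reasoning
  antitone′ : ∀ r → 1 ≤ r → r ≤ n → f (suc r) ℚ.≤ f r
  antitone′ r 1≤r r≤n = antitone r 1≤r (ℕP.m≤n⇒m≤1+n r≤n)

proposition6p1 : (d : ℕ) → 2 ≤ d →
    min1to d (ratio d (oddθ d 2)) ≡ ratio d (oddθ d 2) d
proposition6p1 (suc n) _ = min1to-antitone n (ratio (suc n) (oddθ (suc n) 2))
  (λ r 1≤r r≤n → ratio-antitone r 1≤r (s≤s r≤n))
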